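{- Let $G$ be a graph and let $\mathcal A=\{A, \bar{A}\}$ be a bipartition of $V(G)$ with $q_{\mathcal A}(G)\ge 0$ and $e_G(A,\bar{A})\geq 1$. Let $G'$ be obtained from $G$ by removing one edge between $A$ and $\bar A$. Then $q_{\mathcal A}(G')> q_{\mathcal A}(G)$.
   Context: For a graph $G=(V,E)$ with $m \geq 1$ edges and degrees $d_v$, for $A\subseteq V$ let ${\rm vol}(A)=\sum_{v\in A} d_v$, let $e(A)$ be the number of edges with both ends in $A$, and for disjoint $A,B$ let $e_G(A,B)$ be the number of edges with one end in $A$ and one in $B$. For a partition $\mathcal{A}$ of $V$, $q_{\mathcal A}(G)=\frac{1}{m}\sum_{A\in\mathcal A} e(A)-\frac{1}{4m^2}\sum_{A\in\mathcal A}{\rm vol}(A)^2$. $\bar A=V\setminus A$. -}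

module Defs where

open import Data.Nat using (ℕ; zero; suc; _+_; _*_; _<ᵇ_)
open import Data.Fin using (Fin; zero; suc; toℕ)
open import Data.Bool using (Bool; true; false; if_then_else_; _∧_; not)
open import Data.Integer using (+_)
open import Data.Rational using (ℚ; _/_; _-_; 0ℚ)
open import Relation.Binary.PropositionalEquality using (_≡_)
open import Data.Product using (_×_)
open import Data.Sum using (_⊎_)
open import Data.Empty using (⊥)

sumFin : (n : ℕ) → (Fin n → ℕ) → ℕ
sumFin zero    f = 0
sumFin (suc n) f = f zero + sumFin n (λ i → f (suc i))

[_] : Bool → ℕ
[ b ] = if b then 1 else 0

record Graph (n : ℕ) : Set where
  field
    adj    : Fin n → Fin n → Bool
    sym    : ∀ i j → adj i j ≡ adj j i
    irrefl : ∀ i → adj i i ≡ false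
open Graph public

VSet : ℕ → Set
VSet n = Fin n → Bool

complement : ∀ {n} → VSet n → VSet n
complement A v = not (A v)

deg : ∀ {n} → Graph n → Fin n → ℕ
deg {n} G v = sumFin n (λ j → [ adj G v j ])

eIn : ∀ {n} → Graph n → VSet n → ℕ
eIn {n} G A = sumFin n (λ i → sumFin n (λ j →
  [ (toℕ i <ᵇ toℕ j) ∧ adj G i j ∧ A i ∧ A j ]))

numEdges : ∀ {n} → Graph n → ℕ
numEdges G = eIn G (λ _ → true)

vol : ∀ {n} → Graph n → VSet n → ℕ
vol {n} G A = sumFin n (λ v → if A v then deg G v else 0)

-- e_G(A,B) for disjoint A, B: edges with one end in A and the other in B
eBetween : ∀ {n} → Graph n → VSet n → VSet n → ℕ
eBetween {n} G A B = sumFin n (λ i → sumFin n (λ j → [ adj G i j ∧ A i ∧ B j ]))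

-- (1/m) E - (1/(4 m^2)) S ; the m = 0 case is never used (the paper assumes m ≥ 1)
qFormula : (m E S : ℕ) → ℚ
qFormula zero    E S = 0ℚ
qFormula (suc k) E S = ((+ E) / suc k) - ((+ S) / (4 * suc k * suc k))

qBip : ∀ {n} → Graph n → VSet n → ℚ
qBip G A = qFormula (numEdges G)
                    (eIn G A + eIn G (complement A))
                    (vol G A * vol G A + vol G (complement A) * vol G (complement A))

RemovesEdge : ∀ {n} → Graph n → Graph n → Fin n → Fin n → Set
RemovesEdge {n} G G' u v =
  adj G u v ≡ true × ((adj G' u v ≡ false) × (adj G' v u ≡ false) ×
    (∀ i j → ((i ≡ u × j ≡ v) ⊎ (i ≡ v × j ≡ u) → ⊥) → adj G' i j ≡ adj G i j))

{-# OPTIONS --safe #-}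
module Submission where

-- Removing a crossing edge leaves e(A) + e(Ā) unchanged and lowers m, vol(A) and vol(Ā) by
-- one each.  With n = m − 1 edges left, new volumes x + y = 2n, E internal edges,
-- S' = x² + y² and S = (x + 1)² + (y + 1)² = S' + 4n + 2, the claim
-- E/m − S/4m² < E/n − S'/4n² clears denominators to 4Emn² + S'm² < 4Enm² + Sn².
-- Since S' ≤ (x + y)² = 4n² we get S'm < Sn, and the hypothesis q ≥ 0, i.e. S ≤ 4Em,
-- absorbs the remaining Sn ≤ 4Emn.  For n = 0 the hypothesis fails: E = 0 and q = −1/2.

module GraphCounting where
  open import Data.Nat as ℕ using (ℕ; zero; suc; _+_; _*_; _≤_; _<ᵇ_)
  import Data.Nat.Properties as ℕP
  open import Data.Fin using (Fin; zero; suc; toℕ)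
  open import Data.Fin.Properties using (_≟_; toℕ-injective; suc-injective; 0≢1+n)
  open import Data.Bool using (true; false; _∧_; not; if_then_else_)
  open import Data.Bool.Properties using (∧-zeroʳ; ∧-identityʳ; ∧-comm)
  open import Data.Product using (_×_; _,_)
  open import Data.Sum using (_⊎_; inj₁; inj₂; swap)
  open import Function using (_∘_)
  open import Relation.Nullary using (yes; no; contradiction)
  open import Relation.Nullary.Decidable using (_×-dec_; does; dec-true; dec-false)
  open import Relation.Nullary.Reflects using (ofʸ; ofⁿ)
  open import Relation.Binary.PropositionalEquality hiding ([_])
  import Algebra.Properties.CommutativeMonoid.Sum as MonoidSum
  open import Defs hiding (sym)

  private
    module Σ = MonoidSum ℕP.+-0-commutativeMonoid

  sumFin≡sum : ∀ n (f : Fin n → ℕ) → sumFin n f ≡ Σ.sum f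
  sumFin≡sum zero    f = refl
  sumFin≡sum (suc n) f = cong (f zero +_) (sumFin≡sum n (f ∘ suc))

  sumFin-cong : ∀ n {f g : Fin n → ℕ} → (∀ i → f i ≡ g i) → sumFin n f ≡ sumFin n g
  sumFin-cong zero    f≗g = refl
  sumFin-cong (suc n) f≗g = cong₂ _+_ (f≗g zero) (sumFin-cong n (f≗g ∘ suc))

  sumFin-distrib-+ : ∀ n (f g : Fin n → ℕ) → sumFin n (λ i → f i + g i) ≡ sumFin n f + sumFin n g
  sumFin-distrib-+ n f g = begin
    sumFin n (λ i → f i + g i)  ≡⟨ sumFin≡sum n _ ⟩
    Σ.sum (λ i → f i + g i)     ≡⟨ Σ.∑-distrib-+ f g ⟩
    Σ.sum f + Σ.sum g           ≡⟨ cong₂ _+_ (sumFin≡sum n f) (sumFin≡sum n g) ⟨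
    sumFin n f + sumFin n g     ∎
    where open ≡-Reasoning

  sumFin-comm : ∀ n (f : Fin n → Fin n → ℕ) →
    sumFin n (λ i → sumFin n (f i)) ≡ sumFin n (λ j → sumFin n (λ i → f i j))
  sumFin-comm n f = begin
    sumFin n (λ i → sumFin n (f i))              ≡⟨ sumFin≡sum n _ ⟩
    Σ.sum (λ i → sumFin n (f i))                 ≡⟨ Σ.sum-cong-≗ (λ i → sumFin≡sum n (f i)) ⟩
    Σ.sum (λ i → Σ.sum (f i))                    ≡⟨ Σ.∑-comm f ⟩
    Σ.sum (λ j → Σ.sum (λ i → f i j))            ≡⟨ Σ.sum-cong-≗ (λ j → sumFin≡sum n (λ i → f i j)) ⟨
    Σ.sum (λ j → sumFin n (λ i → f i j))         ≡⟨ sumFin≡sum n _ ⟨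
    sumFin n (λ j → sumFin n (λ i → f i j))      ∎
    where open ≡-Reasoning

  sumFin-mono-≤ : ∀ n {f g : Fin n → ℕ} → (∀ i → f i ≤ g i) → sumFin n f ≤ sumFin n g
  sumFin-mono-≤ zero    f≤g = ℕ.z≤n
  sumFin-mono-≤ (suc n) f≤g = ℕP.+-mono-≤ (f≤g zero) (sumFin-mono-≤ n (f≤g ∘ suc))

  sumFin-suc-at : ∀ n (p : Fin n) {f g : Fin n → ℕ} →
    (∀ i → i ≢ p → f i ≡ g i) → f p ≡ suc (g p) → sumFin n f ≡ suc (sumFin n g)
  sumFin-suc-at (suc n) zero    f≗g fp = cong₂ _+_ fp (sumFin-cong n (λ i → f≗g (suc i) (0≢1+n ∘ sym)))
  sumFin-suc-at (suc n) (suc p) f≗g fp =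
    trans (cong₂ _+_ (f≗g zero 0≢1+n) (sumFin-suc-at n p (λ i i≢p → f≗g (suc i) (i≢p ∘ suc-injective)) fp))
          (ℕP.+-suc _ _)

  adj-by-order : ∀ {n} (G : Graph n) i j →
    [ adj G i j ] ≡ [ (toℕ i <ᵇ toℕ j) ∧ adj G i j ] + [ (toℕ j <ᵇ toℕ i) ∧ adj G j i ]
  adj-by-order G i j
    with toℕ i <ᵇ toℕ j | ℕP.<ᵇ-reflects-< (toℕ i) (toℕ j) | toℕ j <ᵇ toℕ i | ℕP.<ᵇ-reflects-< (toℕ j) (toℕ i)
  ... | true  | ofʸ i<j | true  | ofʸ j<i = contradiction j<i (ℕP.<-asym i<j)
  ... | true  | _       | false | _       = sym (ℕP.+-identityʳ _)
  ... | false | _       | true  | _       = cong [_] (Graph.sym G i j)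
  ... | false | ofⁿ i≮j | false | ofⁿ j≮i with toℕ-injective (ℕP.≤-antisym (ℕP.≮⇒≥ j≮i) (ℕP.≮⇒≥ i≮j))
  ...   | refl = cong [_] (irrefl G i)

  handshake : ∀ {n} (G : Graph n) → sumFin n (deg G) ≡ 2 * numEdges G
  handshake {n} G = begin
    sumFin n (deg G)
      ≡⟨ sumFin-cong n (λ i → trans (sumFin-cong n (adj-by-order G i)) (sumFin-distrib-+ n _ _)) ⟩
    sumFin n (λ i → sumFin n (ordered i) + sumFin n (λ j → ordered j i))
      ≡⟨ sumFin-distrib-+ n _ _ ⟩
    sumFin n (λ i → sumFin n (ordered i)) + sumFin n (λ i → sumFin n (λ j → ordered j i))
      ≡⟨ cong (sumFin n (λ i → sumFin n (ordered i)) +_) (sumFin-comm n (λ i j → ordered j i)) ⟩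
    sumFin n (λ i → sumFin n (ordered i)) + sumFin n (λ i → sumFin n (ordered i))
      ≡⟨ cong (λ m → m + m) ordered-count ⟩
    numEdges G + numEdges G
      ≡⟨ cong (numEdges G +_) (ℕP.+-identityʳ (numEdges G)) ⟨
    2 * numEdges G ∎
    where
    open ≡-Reasoning
    ordered : Fin n → Fin n → ℕ
    ordered i j = [ (toℕ i <ᵇ toℕ j) ∧ adj G i j ]
    ordered-count : sumFin n (λ i → sumFin n (ordered i)) ≡ numEdges G
    ordered-count = sumFin-cong n (λ i → sumFin-cong n (λ j →
      cong (λ b → [ (toℕ i <ᵇ toℕ j) ∧ b ]) (sym (∧-identityʳ (adj G i j)))))

  vol-complement : ∀ {n} (G : Graph n) (A : VSet n) → vol G A + vol G (complement A) ≡ sumFin n (deg G)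
  vol-complement {n} G A = trans (sym (sumFin-distrib-+ n _ _)) (sumFin-cong n split)
    where
    split : ∀ w → (if A w then deg G w else 0) + (if not (A w) then deg G w else 0) ≡ deg G w
    split w with A w
    ... | true  = ℕP.+-identityʳ (deg G w)
    ... | false = refl

  sameSide-≤ : ∀ l a x y → [ l ∧ a ∧ x ∧ y ] + [ l ∧ a ∧ not x ∧ not y ] ≤ [ l ∧ a ∧ true ∧ true ]
  sameSide-≤ false a     x     y     = ℕ.z≤n
  sameSide-≤ true  false x     y     = ℕ.z≤n
  sameSide-≤ true  true  true  true  = ℕP.≤-refl
  sameSide-≤ true  true  true  false = ℕ.z≤n
  sameSide-≤ true  true  false true  = ℕ.z≤n
  sameSide-≤ true  true  false false = ℕP.≤-refl

  eIn-complement-≤ : ∀ {n} (G : Graph n) (A : VSet n) → eIn G A + eIn G (complement A) ≤ numEdges G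
  eIn-complement-≤ {n} G A = subst (_≤ numEdges G) (sumFin-distrib-+ n _ _)
    (sumFin-mono-≤ n (λ i → subst (_≤ _) (sumFin-distrib-+ n _ _)
      (sumFin-mono-≤ n (λ j → sameSide-≤ (toℕ i <ᵇ toℕ j) (adj G i j) (A i) (A j)))))

  module _ {n} (G G' : Graph n) (u v : Fin n) where

    RemovesEdge-sym : RemovesEdge G G' u v → RemovesEdge G G' v u
    RemovesEdge-sym (uv , uv' , vu' , rest) =
      trans (Graph.sym G v u) uv , vu' , uv' , λ i j ne → rest i j (ne ∘ swap)

    removeEdge-≢ : RemovesEdge G G' u v → u ≢ v
    removeEdge-≢ (uv , _) refl with trans (sym uv) (irrefl G u)
    ... | ()

    removeEdge-adj : RemovesEdge G G' u v →
      ∀ i j → adj G' i j ≡ adj G i j ⊎ (i ≡ u × j ≡ v) ⊎ (i ≡ v × j ≡ u)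
    removeEdge-adj (_ , _ , _ , rest) i j with (i ≟ u) ×-dec (j ≟ v) | (i ≟ v) ×-dec (j ≟ u)
    ... | yes uv | _      = inj₂ (inj₁ uv)
    ... | no _   | yes vu = inj₂ (inj₂ vu)
    ... | no ¬uv | no ¬vu = inj₁ (rest i j λ { (inj₁ uv) → ¬uv uv ; (inj₂ vu) → ¬vu vu })

    deg-removeEdge-≢ : RemovesEdge G G' u v → ∀ {w} → w ≢ u → w ≢ v → deg G' w ≡ deg G w
    deg-removeEdge-≢ removes {w} w≢u w≢v = sumFin-cong n (λ j → cong [_] (same j))
      where
      same : ∀ j → adj G' w j ≡ adj G w j
      same j with removeEdge-adj removes w j
      ... | inj₁ eq              = eq
      ... | inj₂ (inj₁ (w≡u , _)) = contradiction w≡u w≢u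
      ... | inj₂ (inj₂ (w≡v , _)) = contradiction w≡v w≢v

    deg-removeEdge : RemovesEdge G G' u v → deg G u ≡ suc (deg G' u)
    deg-removeEdge removes@(uv , uv' , _) =
      sumFin-suc-at n v (λ j j≢v → cong [_] (sym (same j j≢v))) (trans (cong [_] uv) (cong (suc ∘ [_]) (sym uv')))
      where
      same : ∀ j → j ≢ v → adj G' u j ≡ adj G u j
      same j j≢v with removeEdge-adj removes u j
      ... | inj₁ eq              = eq
      ... | inj₂ (inj₁ (_ , j≡v)) = contradiction j≡v j≢v
      ... | inj₂ (inj₂ (u≡v , _)) = contradiction u≡v (removeEdge-≢ removes)

    vol-removeEdge : RemovesEdge G G' u v → ∀ (B : VSet n) → B u ≡ true → B v ≡ false →
      vol G B ≡ suc (vol G' B)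
    vol-removeEdge removes B Bu Bv = sumFin-suc-at n u others at-u
      where
      others : ∀ w → w ≢ u → (if B w then deg G w else 0) ≡ (if B w then deg G' w else 0)
      others w w≢u with B w in Bw
      ... | true  = sym (deg-removeEdge-≢ removes w≢u λ { refl → contradiction (trans (sym Bw) Bv) λ () })
      ... | false = refl
      at-u : (if B u then deg G u else 0) ≡ suc (if B u then deg G' u else 0)
      at-u rewrite Bu = deg-removeEdge removes

    eIn-removeEdge : RemovesEdge G G' u v → ∀ (B : VSet n) → B u ∧ B v ≡ false → eIn G' B ≡ eIn G B
    eIn-removeEdge removes B Buv = sumFin-cong n (λ i → sumFin-cong n (λ j → same i j))
      where
      outside : ∀ (H : Graph n) i j → B i ∧ B j ≡ false →
        [ (toℕ i <ᵇ toℕ j) ∧ adj H i j ∧ B i ∧ B j ] ≡ 0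
      outside H i j Bij rewrite Bij =
        cong [_] (trans (cong ((toℕ i <ᵇ toℕ j) ∧_) (∧-zeroʳ (adj H i j))) (∧-zeroʳ _))
      Bvu : B v ∧ B u ≡ false
      Bvu = trans (∧-comm (B v) (B u)) Buv
      same : ∀ i j → [ (toℕ i <ᵇ toℕ j) ∧ adj G' i j ∧ B i ∧ B j ] ≡ [ (toℕ i <ᵇ toℕ j) ∧ adj G i j ∧ B i ∧ B j ]
      same i j with removeEdge-adj removes i j
      ... | inj₁ eq = cong (λ a → [ (toℕ i <ᵇ toℕ j) ∧ a ∧ B i ∧ B j ]) eq
      ... | inj₂ (inj₁ (refl , refl)) = trans (outside G' i j Buv) (sym (outside G i j Buv))
      ... | inj₂ (inj₂ (refl , refl)) = trans (outside G' i j Bvu) (sym (outside G i j Bvu))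

  numEdges-removeEdge : ∀ {n} (G G' : Graph n) (u v : Fin n) → RemovesEdge G G' u v →
    numEdges G ≡ suc (numEdges G')
  numEdges-removeEdge {n} G G' u v removes = ℕP.*-cancelˡ-≡ (numEdges G) (suc (numEdges G')) 2 (begin
    2 * numEdges G                                 ≡⟨ handshake G ⟨
    sumFin n (deg G)                               ≡⟨ vol-complement G B ⟨
    vol G B + vol G (complement B)                 ≡⟨ cong₂ _+_ (vol-removeEdge G G' u v removes B Bu Bv)
                                                        (vol-removeEdge G G' v u removes-vu (complement B) (cong not Bv) (cong not Bu)) ⟩
    suc (vol G' B) + suc (vol G' (complement B))   ≡⟨ cong suc (ℕP.+-suc (vol G' B) _) ⟩
    2 + (vol G' B + vol G' (complement B))         ≡⟨ cong (2 +_) (trans (vol-complement G' B) (handshake G')) ⟩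
    2 + 2 * numEdges G'                            ≡⟨ ℕP.*-distribˡ-+ 2 1 (numEdges G') ⟨
    2 * suc (numEdges G')                          ∎)
    where
    open ≡-Reasoning
    B : VSet n
    B w = does (w ≟ u)
    Bu : B u ≡ true
    Bu = dec-true (u ≟ u) refl
    Bv : B v ≡ false
    Bv = dec-false (v ≟ u) (λ v≡u → removeEdge-≢ G G' u v removes (sym v≡u))
    removes-vu : RemovesEdge G G' v u
    removes-vu = RemovesEdge-sym G G' u v removes

  qBip-removeEdge : ∀ {n} (G G' : Graph n) (A : VSet n) (u v : Fin n) → RemovesEdge G G' u v →
    A u ≡ true → A v ≡ false →
    qBip G A ≡ qFormula (suc (numEdges G')) (eIn G' A + eIn G' (complement A))
                        (suc (vol G' A) * suc (vol G' A) + suc (vol G' (complement A)) * suc (vol G' (complement A)))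
  qBip-removeEdge G G' A u v removes Au Av =
    qFormula-cong (numEdges-removeEdge G G' u v removes) internal-same volumes-shift
    where
    qFormula-cong : ∀ {m m' E E' S S'} → m ≡ m' → E ≡ E' → S ≡ S' → qFormula m E S ≡ qFormula m' E' S'
    qFormula-cong refl refl refl = refl
    internal-same : eIn G A + eIn G (complement A) ≡ eIn G' A + eIn G' (complement A)
    internal-same = sym (cong₂ _+_
      (eIn-removeEdge G G' u v removes A (cong₂ _∧_ Au Av))
      (eIn-removeEdge G G' u v removes (complement A) (cong₂ _∧_ (cong not Au) (cong not Av))))
    volumes-shift : vol G A * vol G A + vol G (complement A) * vol G (complement A)
      ≡ suc (vol G' A) * suc (vol G' A) + suc (vol G' (complement A)) * suc (vol G' (complement A))
    volumes-shift = cong₂ (λ a b → a * a + b * b)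
      (vol-removeEdge G G' u v removes A Au Av)
      (vol-removeEdge G G' v u (RemovesEdge-sym G G' u v removes)
        (complement A) (cong not Av) (cong not Au))

module ModularityArithmetic where
  open import Data.Nat as ℕ using (ℕ; zero; suc; _+_; _*_; _≤_; _<_)
  import Data.Nat.Properties as ℕP
  import Data.Nat.Tactic.RingSolver as ℕ-Solver
  open import Data.Integer as ℤ using (ℤ; +_; -_)
  import Data.Integer.Properties as ℤP
  import Data.Integer.Tactic.RingSolver as ℤ-Solver
  open import Data.Rational as ℚ using (ℚ; 0ℚ; toℚᵘ)
  import Data.Rational.Properties as ℚP
  open import Data.Rational.Unnormalised as ℚᵘ using (mkℚᵘ; *<*; *≤*)
  import Data.Rational.Unnormalised.Properties as ℚᵘP
  open import Relation.Binary.PropositionalEquality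
  open import Defs hiding (sym)

  pos-*³ : ∀ a b c d → + (a * b * c * d) ≡ + a ℤ.* + b ℤ.* + c ℤ.* + d
  pos-*³ a b c d = begin
    + (a * b * c * d)               ≡⟨ ℤP.pos-* (a * b * c) d ⟩
    + (a * b * c) ℤ.* + d           ≡⟨ cong (ℤ._* + d) (ℤP.pos-* (a * b) c) ⟩
    + (a * b) ℤ.* + c ℤ.* + d       ≡⟨ cong (λ t → t ℤ.* + c ℤ.* + d) (ℤP.pos-* a b) ⟩
    + a ℤ.* + b ℤ.* + c ℤ.* + d     ∎
    where open ≡-Reasoning

  fraction-sub-nonneg : ∀ a p b q →
    ℚᵘ.0ℚᵘ ℚᵘ.≤ mkℚᵘ (+ a) p ℚᵘ.- mkℚᵘ (+ b) q → b * suc p ≤ a * suc q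
  fraction-sub-nonneg a p b q (*≤* le) =
    ℤP.drop‿+≤+ (subst₂ ℤ._≤_ (sym (ℤP.pos-* b (suc p))) (sym (ℤP.pos-* a (suc q)))
      (ℤP.0≤i-j⇒j≤i (subst₂ ℤ._≤_ (ℤP.*-zeroˡ (+ (suc p * suc q)))
        (difference (+ a) (+ b) (+ suc p) (+ suc q)) le)))
    where
    difference : ∀ a b P Q → (a ℤ.* Q ℤ.+ - b ℤ.* P) ℤ.* + 1 ≡ a ℤ.* Q ℤ.- b ℤ.* P
    difference = ℤ-Solver.solve-∀

  pos-*³-+ : ∀ a b c d e f g h →
    + (a * b * c * d + e * f * g * h) ≡ + a ℤ.* + b ℤ.* + c ℤ.* + d ℤ.+ + e ℤ.* + f ℤ.* + g ℤ.* + h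
  pos-*³-+ a b c d e f g h =
    trans (ℤP.pos-+ (a * b * c * d) (e * f * g * h)) (cong₂ ℤ._+_ (pos-*³ a b c d) (pos-*³ e f g h))

  -- Cross-multiply by PQRS and add bPRS + dRPQ to both sides.
  fraction-sub-< : ∀ a p b q c r d s →
    a * suc q * suc r * suc s + d * suc r * suc p * suc q
      < c * suc s * suc p * suc q + b * suc p * suc r * suc s →
    mkℚᵘ (+ a) p ℚᵘ.- mkℚᵘ (+ b) q ℚᵘ.< mkℚᵘ (+ c) r ℚᵘ.- mkℚᵘ (+ d) s
  fraction-sub-< a p b q c r d s lt =
    *<* (subst₂ ℤ._<_ numerator-L numerator-R (ℤP.+-monoˡ-< (- N) (ℤ.+<+ lt)))
    where
    P Q R S : ℕ
    P = suc p; Q = suc q; R = suc r; S = suc s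
    N : ℤ
    N = + b ℤ.* + P ℤ.* + R ℤ.* + S ℤ.+ + d ℤ.* + R ℤ.* + P ℤ.* + Q
    regroup-L : ∀ a b d P Q R S →
      a ℤ.* Q ℤ.* R ℤ.* S ℤ.+ d ℤ.* R ℤ.* P ℤ.* Q ℤ.- (b ℤ.* P ℤ.* R ℤ.* S ℤ.+ d ℤ.* R ℤ.* P ℤ.* Q)
        ≡ (a ℤ.* Q ℤ.+ - b ℤ.* P) ℤ.* (R ℤ.* S)
    regroup-L = ℤ-Solver.solve-∀
    regroup-R : ∀ b c d P Q R S →
      c ℤ.* S ℤ.* P ℤ.* Q ℤ.+ b ℤ.* P ℤ.* R ℤ.* S ℤ.- (b ℤ.* P ℤ.* R ℤ.* S ℤ.+ d ℤ.* R ℤ.* P ℤ.* Q)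
        ≡ (c ℤ.* S ℤ.+ - d ℤ.* R) ℤ.* (P ℤ.* Q)
    regroup-R = ℤ-Solver.solve-∀
    numerator-L : + (a * Q * R * S + d * R * P * Q) ℤ.- N ≡ (+ a ℤ.* + Q ℤ.+ - + b ℤ.* + P) ℤ.* + (R * S)
    numerator-L = begin
      + (a * Q * R * S + d * R * P * Q) ℤ.- N
        ≡⟨ cong (ℤ._- N) (pos-*³-+ a Q R S d R P Q) ⟩
      + a ℤ.* + Q ℤ.* + R ℤ.* + S ℤ.+ + d ℤ.* + R ℤ.* + P ℤ.* + Q ℤ.- N
        ≡⟨ regroup-L (+ a) (+ b) (+ d) (+ P) (+ Q) (+ R) (+ S) ⟩
      (+ a ℤ.* + Q ℤ.+ - + b ℤ.* + P) ℤ.* (+ R ℤ.* + S)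
        ≡⟨ cong ((+ a ℤ.* + Q ℤ.+ - + b ℤ.* + P) ℤ.*_) (ℤP.pos-* R S) ⟨
      (+ a ℤ.* + Q ℤ.+ - + b ℤ.* + P) ℤ.* + (R * S) ∎
      where open ≡-Reasoning
    numerator-R : + (c * S * P * Q + b * P * R * S) ℤ.- N ≡ (+ c ℤ.* + S ℤ.+ - + d ℤ.* + R) ℤ.* + (P * Q)
    numerator-R = begin
      + (c * S * P * Q + b * P * R * S) ℤ.- N
        ≡⟨ cong (ℤ._- N) (pos-*³-+ c S P Q b P R S) ⟩
      + c ℤ.* + S ℤ.* + P ℤ.* + Q ℤ.+ + b ℤ.* + P ℤ.* + R ℤ.* + S ℤ.- N
        ≡⟨ regroup-R (+ b) (+ c) (+ d) (+ P) (+ Q) (+ R) (+ S) ⟩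
      (+ c ℤ.* + S ℤ.+ - + d ℤ.* + R) ℤ.* (+ P ℤ.* + Q)
        ≡⟨ cong ((+ c ℤ.* + S ℤ.+ - + d ℤ.* + R) ℤ.*_) (ℤP.pos-* P Q) ⟨
      (+ c ℤ.* + S ℤ.+ - + d ℤ.* + R) ℤ.* + (P * Q) ∎
      where open ≡-Reasoning

  toℚᵘ-qFormula : ∀ k E S →
    toℚᵘ (qFormula (suc k) E S) ℚᵘ.≃ (+ E ℚᵘ./ suc k) ℚᵘ.- (+ S ℚᵘ./ (4 * suc k * suc k))
  toℚᵘ-qFormula k E S = ℚᵘP.≃-trans (ℚP.toℚᵘ-homo-+ p (ℚ.- q))
    (ℚᵘP.+-cong (toℚᵘ-/ E (suc k))
      (ℚᵘP.≃-trans (ℚP.toℚᵘ-homo‿- q) (ℚᵘP.-‿cong (toℚᵘ-/ S (4 * suc k * suc k)))))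
    where
    p q : ℚ
    p = + E ℚ./ suc k
    q = + S ℚ./ (4 * suc k * suc k)
    toℚᵘ-/ : ∀ a d .{{_ : ℕ.NonZero d}} → toℚᵘ (+ a ℚ./ d) ℚᵘ.≃ (+ a ℚᵘ./ d)
    toℚᵘ-/ a (suc d) = ℚP.toℚᵘ-fromℚᵘ (mkℚᵘ (+ a) d)

  qFormula-nonneg : ∀ k E S → 0ℚ ℚ.≤ qFormula (suc k) E S → S ≤ 4 * E * suc k
  qFormula-nonneg k E S nonneg = ℕP.*-cancelʳ-≤ S (4 * E * suc k) (suc k)
    (subst (S * suc k ≤_) (regroup E (suc k))
      (fraction-sub-nonneg E k S _ (ℚᵘP.≤-respʳ-≃ (toℚᵘ-qFormula k E S) (ℚP.toℚᵘ-mono-≤ nonneg))))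
    where
    regroup : ∀ E m → E * (4 * m * m) ≡ 4 * E * m * m
    regroup = ℕ-Solver.solve-∀

  qFormula-< : ∀ k l E E' S S' →
    4 * E * suc k * (suc l * suc l) + S' * (suc k * suc k) < 4 * E' * suc l * (suc k * suc k) + S * (suc l * suc l) →
    qFormula (suc k) E S ℚ.< qFormula (suc l) E' S'
  qFormula-< k l E E' S S' lt = ℚP.toℚᵘ-cancel-<
    (ℚᵘP.<-respʳ-≃ (ℚᵘP.≃-sym (toℚᵘ-qFormula l E' S'))
      (ℚᵘP.<-respˡ-≃ (ℚᵘP.≃-sym (toℚᵘ-qFormula k E S))
        (fraction-sub-< E k S _ E' l S' _
          (subst₂ _<_ (scale-L E S' (suc k) (suc l)) (scale-R E' S (suc k) (suc l)) (ℕP.*-monoˡ-< (4 * suc k * suc l) lt)))))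
    where
    scale-L : ∀ E S' m n →
      (4 * E * m * (n * n) + S' * (m * m)) * (4 * m * n) ≡ E * (4 * m * m) * n * (4 * n * n) + S' * n * m * (4 * m * m)
    scale-L = ℕ-Solver.solve-∀
    scale-R : ∀ E' S m n →
      (4 * E' * n * (m * m) + S * (n * n)) * (4 * m * n) ≡ E' * (4 * n * n) * m * (4 * m * m) + S * m * n * (4 * n * n)
    scale-R = ℕ-Solver.solve-∀

  sumSq-≤-sqSum : ∀ x y → x * x + y * y ≤ (x + y) * (x + y)
  sumSq-≤-sqSum x y = subst (x * x + y * y ≤_) (expand x y) (ℕP.m≤m+n (x * x + y * y) (2 * (x * y)))
    where
    expand : ∀ x y → x * x + y * y + 2 * (x * y) ≡ (x + y) * (x + y)
    expand = ℕ-Solver.solve-∀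

  sqSum-< : ∀ x y n → x + y ≡ 2 * suc n →
    (x * x + y * y) * suc (suc n) < (suc x * suc x + suc y * suc y) * suc n
  sqSum-< x y n x+y≡2n = begin-strict
    S' * suc (suc n)                        ≡⟨ ℕP.*-suc S' (suc n) ⟩
    S' + S' * suc n                         ≤⟨ ℕP.+-monoˡ-≤ (S' * suc n) (sumSq-≤-sqSum x y) ⟩
    (x + y) * (x + y) + S' * suc n          ≡⟨ cong (λ t → t * t + S' * suc n) x+y≡2n ⟩
    2 * suc n * (2 * suc n) + S' * suc n    <⟨ ℕP.m<n+m _ ℕ.z<s ⟩
    2 * suc n + (2 * suc n * (2 * suc n) + S' * suc n)  ≡⟨ regroup S' (suc n) ⟩
    (S' + 2 * (2 * suc n) + 2) * suc n      ≡⟨ cong (λ t → (S' + 2 * t + 2) * suc n) x+y≡2n ⟨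
    (S' + 2 * (x + y) + 2) * suc n          ≡⟨ cong (_* suc n) (expand x y) ⟩
    (suc x * suc x + suc y * suc y) * suc n ∎
    where
    open ℕP.≤-Reasoning
    S' : ℕ
    S' = x * x + y * y
    regroup : ∀ S' n → 2 * n + (2 * n * (2 * n) + S' * n) ≡ (S' + 2 * (2 * n) + 2) * n
    regroup = ℕ-Solver.solve-∀
    expand : ∀ x y → x * x + y * y + 2 * (x + y) + 2 ≡ suc x * suc x + suc y * suc y
    expand = ℕ-Solver.solve-∀

  cross-< : ∀ E S S' n → S ≤ 4 * E * suc n → S' * suc n < S * n →
    4 * E * suc n * (n * n) + S' * (suc n * suc n) < 4 * E * n * (suc n * suc n) + S * (n * n)
  cross-< E S S' n S≤4Em S'm<Sn = begin-strict
    T + S' * (suc n * suc n)              ≡⟨ cong (λ t → T + t) (ℕP.*-assoc S' (suc n) (suc n)) ⟨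
    T + S' * suc n * suc n                <⟨ ℕP.+-monoʳ-< T (ℕP.*-monoˡ-< (suc n) S'm<Sn) ⟩
    T + S * n * suc n                     ≡⟨ split T S n ⟩
    T + S * (n * n) + S * n               ≤⟨ ℕP.+-monoʳ-≤ (T + S * (n * n)) (ℕP.*-monoˡ-≤ n S≤4Em) ⟩
    T + S * (n * n) + 4 * E * suc n * n   ≡⟨ merge E S n ⟩
    4 * E * n * (suc n * suc n) + S * (n * n) ∎
    where
    open ℕP.≤-Reasoning
    T : ℕ
    T = 4 * E * suc n * (n * n)
    split : ∀ T S n → T + S * n * suc n ≡ T + S * (n * n) + S * n
    split = ℕ-Solver.solve-∀
    merge : ∀ E S n →
      4 * E * suc n * (n * n) + S * (n * n) + 4 * E * suc n * n ≡ 4 * E * n * (suc n * suc n) + S * (n * n)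
    merge = ℕ-Solver.solve-∀

  qFormula-removeEdge-< : ∀ n E x y → x + y ≡ 2 * n → E ≤ n →
    0ℚ ℚ.≤ qFormula (suc n) E (suc x * suc x + suc y * suc y) →
    qFormula (suc n) E (suc x * suc x + suc y * suc y) ℚ.< qFormula n E (x * x + y * y)
  qFormula-removeEdge-< zero .zero x y _ ℕ.z≤n nonneg with qFormula-nonneg 0 0 (suc x * suc x + suc y * suc y) nonneg
  ... | ()
  qFormula-removeEdge-< (suc k) E x y x+y≡2n _ nonneg =
    qFormula-< (suc k) k E E S (x * x + y * y)
      (cross-< E S (x * x + y * y) (suc k) (qFormula-nonneg (suc k) E S nonneg) (sqSum-< x y k x+y≡2n))
    where
    S : ℕ
    S = suc x * suc x + suc y * suc y

open import Defs
open import Data.Nat using (_≥_)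
open import Data.Fin using (Fin)
open import Data.Bool using (true; false)
open import Data.Rational using (_≤_; _<_; 0ℚ)
open import Relation.Binary.PropositionalEquality using (_≡_)

open import Data.Nat using (ℕ; suc; _+_; _*_)
import Relation.Binary.PropositionalEquality as Eq
open GraphCounting using (handshake; vol-complement; eIn-complement-≤; qBip-removeEdge)
open ModularityArithmetic using (qFormula-removeEdge-<)

lemma2p1 : ∀ {n} (G G' : Graph n) (A : VSet n) (u v : Fin n) →
    0ℚ ≤ qBip G A →
    eBetween G A (complement A) ≥ 1 →
    A u ≡ true → A v ≡ false → RemovesEdge G G' u v →
    qBip G A < qBip G' A
-- The crossing edge uv itself already witnesses e(A, Ā) ≥ 1.
lemma2p1 G G' A u v nonneg _ Au Av removes =
  Eq.subst (_< qBip G' A) (Eq.sym qBip-G)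
    (qFormula-removeEdge-< m E x y
      (Eq.trans (vol-complement G' A) (handshake G'))
      (eIn-complement-≤ G' A)
      (Eq.subst (0ℚ ≤_) qBip-G nonneg))
  where
  m E x y : ℕ
  m = numEdges G'
  E = eIn G' A + eIn G' (complement A)
  x = vol G' A
  y = vol G' (complement A)
  qBip-G : qBip G A ≡ qFormula (suc m) E (suc x * suc x + suc y * suc y)
  qBip-G = qBip-removeEdge G G' A u v removes Au Av
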